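{- Let $F\in\{S,R,T\}$, let $G$ be any simple graph and let $H$ be a dispersable bipartite graph. If $F(G)$ is dispersable, then $G+_F H$ is dispersable, i.e. $\operatorname{mbt}(G+_F H)=\Delta(G+_F H)$.
   Context: Matching book embedding: the vertices are placed in a linear order along a spine and each edge is assigned to a page (half-plane bounded by the spine) so that no two edges on the same page cross and every vertex is incident with at most one edge on each page. $\operatorname{mbt}(G)$ is the minimum number of pages of a matching book embedding of $G$. $G$ is dispersable if $\operatorname{mbt}(G)=\Delta(G)$, where $\Delta$ denotes maximum degree. For a graph $G$: $S(G)$ is obtained by inserting a new vertex into each edge of $G$. $R(G)$ is obtained from $G$ by adding, for each edge $uv$, a new vertex adjacent to $u$ and $v$; the original edges are kept. $T(G)$ has vertex set $V(G)\cup E(G)$, with adjacency meaning adjacency or incidence of the corresponding elements of $G$. In each case $V(F(G))=V(G)\cup E(G)$. The $F$-sum $G+_F H$ has vertex set $(V(G)\cup E(G))\times V(H)$. Two vertices $(u_1,u_2)$ and $(v_1,v_2)$ are adjacent if and only if either $u_1=v_1\in V(G)$ and $u_2v_2\in E(H)$, or $u_2=v_2$ and $u_1v_1\in E(F(G))$. -}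

module Defs where

open import Data.Nat using (ℕ; _≤_; _<_)
open import Data.Fin using (Fin) renaming (_<_ to _<ᶠ_)
open import Data.Bool using (Bool; true; false)
open import Data.List using (List; length)
open import Data.List.Membership.Propositional using (_∈_)
open import Data.List.Relation.Unary.Unique.Propositional using (Unique)
open import Data.Product using (Σ; Σ-syntax; ∃; ∃-syntax; _×_; _,_; proj₁; proj₂)
open import Data.Sum using (_⊎_; inj₁; inj₂)
open import Data.Empty using (⊥)
open import Relation.Nullary using (¬_)
open import Relation.Binary.PropositionalEquality using (_≡_; _≢_)
open import Function.Definitions using (Injective)

record SimpleGraph : Set where
  field
    n      : ℕ
    adj    : Fin n → Fin n → Bool
    sym    : ∀ i j → adj i j ≡ adj j i
    irrefl : ∀ i → adj i i ≡ false
open SimpleGraph public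

record Graph : Set₁ where
  field
    V   : Set
    Adj : V → V → Set
open Graph public

toGraph : SimpleGraph → Graph
toGraph G = record { V = Fin (n G) ; Adj = λ i j → adj G i j ≡ true }

HasDegree : (G : Graph) → V G → ℕ → Set
HasDegree G v d =
  Σ[ l ∈ List (V G) ] Unique l
    × (∀ w → (w ∈ l → Adj G v w) × (Adj G v w → w ∈ l))
    × length l ≡ d

-- d = Δ(G): every vertex has finite degree ≤ d, and d is attained
-- (or d = 0, the convention for graphs without vertices)
IsMaxDegree : Graph → ℕ → Set
IsMaxDegree G d =
  (∀ v → Σ[ d' ∈ ℕ ] HasDegree G v d' × d' ≤ d)
  × (d ≡ 0 ⊎ Σ[ v ∈ V G ] HasDegree G v d)

-- A matching book embedding with k pages: a linear order of the
-- vertices along the spine (injective position map into ℕ) and a page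
-- for every edge such that edges on the same page do not cross and
-- each vertex has at most one incident edge on each page.
record MBE (G : Graph) (k : ℕ) : Set where
  field
    pos      : V G → ℕ
    pos-inj  : Injective _≡_ _≡_ pos
    page     : V G → V G → Fin k
    page-sym : ∀ u v → Adj G u v → page u v ≡ page v u
    matching : ∀ u v w → Adj G u v → Adj G u w → page u v ≡ page u w → v ≡ w
    noCross  : ∀ u v x y → Adj G u v → Adj G x y → page u v ≡ page x y →
               ¬ (pos u < pos x × pos x < pos v × pos v < pos y)

IsMbt : Graph → ℕ → Set
IsMbt G k = MBE G k × (∀ k' → MBE G k' → k ≤ k')

Dispersable : Graph → Set
Dispersable G = Σ[ d ∈ ℕ ] IsMaxDegree G d × IsMbt G d

Bipartite : SimpleGraph → Set
Bipartite H = Σ[ c ∈ (Fin (n H) → Bool) ] (∀ i j → adj H i j ≡ true → c i ≢ c j)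

Edge : SimpleGraph → Set
Edge G = Σ[ i ∈ Fin (n G) ] Σ[ j ∈ Fin (n G) ] (i <ᶠ j × adj G i j ≡ true)

src tgt : ∀ {G} → Edge G → Fin (n G)
src (i , _ , _) = i
tgt (_ , j , _) = j

Incident : ∀ {G} → Fin (n G) → Edge G → Set
Incident {G} v e = v ≡ src {G} e ⊎ v ≡ tgt {G} e

EdgesAdjacent : ∀ {G} → Edge G → Edge G → Set
EdgesAdjacent {G} e f = (src {G} e ≢ src {G} f ⊎ tgt {G} e ≢ tgt {G} f)
  × Σ[ v ∈ Fin (n G) ] Incident {G} v e × Incident {G} v f

data Op : Set where
  S R T : Op

FV : SimpleGraph → Set
FV G = Fin (n G) ⊎ Edge G

FAdj : Op → (G : SimpleGraph) → FV G → FV G → Set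
FAdj S G (inj₁ u) (inj₁ v) = ⊥
FAdj S G (inj₁ u) (inj₂ e) = Incident {G} u e
FAdj S G (inj₂ e) (inj₁ u) = Incident {G} u e
FAdj S G (inj₂ e) (inj₂ f) = ⊥
FAdj R G (inj₁ u) (inj₁ v) = adj G u v ≡ true
FAdj R G (inj₁ u) (inj₂ e) = Incident {G} u e
FAdj R G (inj₂ e) (inj₁ u) = Incident {G} u e
FAdj R G (inj₂ e) (inj₂ f) = ⊥
FAdj T G (inj₁ u) (inj₁ v) = adj G u v ≡ true
FAdj T G (inj₁ u) (inj₂ e) = Incident {G} u e
FAdj T G (inj₂ e) (inj₁ u) = Incident {G} u e
FAdj T G (inj₂ e) (inj₂ f) = EdgesAdjacent {G} e f

FG : Op → SimpleGraph → Graph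
FG F G = record { V = FV G ; Adj = FAdj F G }

FSum : Op → SimpleGraph → SimpleGraph → Graph
FSum F G H = record
  { V   = FV G × Fin (n H)
  ; Adj = λ { (u₁ , u₂) (v₁ , v₂) →
              (Σ[ w ∈ Fin (n G) ] (u₁ ≡ inj₁ w × v₁ ≡ inj₁ w × adj H u₂ v₂ ≡ true))
              ⊎ (u₂ ≡ v₂ × FAdj F G u₁ v₁) } }

-- Let Δ_F and Δ_H be the maximum degrees of F(G) and H. In G +_F H the vertex (w, h) with w ∈ V(G) has
-- degree deg_F(G) w + deg_H h, and the vertex (e, h) with e ∈ E(G) has degree deg_F(G) e. Lay out copies
-- of a matching book embedding of F(G) one after another, in the spine order of H, and mirror the copies
-- over one colour class of H. Then the copies of each H-edge are nested, so the pages of F(G) together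
-- with Δ_H new pages for the copies of H give an embedding with Δ_F + Δ_H pages. This is optimal when Δ_F
-- is attained at an original vertex or H has no edges. Otherwise Δ_F is attained only at subdivision
-- vertices. This cannot happen for R, since deg_R(uv) = 2 ≤ deg_R u, or for T, since
-- 2 deg_T(uv) = deg_T u + deg_T v. For S it forces G to be a matching. Then S(G) is a union of paths
-- u – uv – v that fit on consecutive spine positions, so its two pages can be shared with the copies of
-- H, and Δ_H + 1 pages suffice.
module Submission where

open import Defs hiding (sym)

open import Axiom.UniquenessOfIdentityProofs using (module Decidable⇒UIP)
open import Data.Bool using (Bool; true; false)
import Data.Bool.Properties as Bool
open import Data.Empty using (⊥; ⊥-elim)
open import Data.Fin using (Fin; zero; suc; toℕ; _↑ˡ_; _↑ʳ_; splitAt) renaming (_<_ to _<ᶠ_)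
import Data.Fin.Properties as Fin
open import Data.List using (List; []; _∷_; length; map; _++_; allFin)
open import Data.List.Properties using (length-map; length-++; length-tabulate; length-removeAt′)
open import Data.List.Membership.Propositional using (_∈_)
open import Data.List.Membership.Propositional.Properties
  using (∈-allFin; ∈-map⁺; ∈-map⁻; ∈-++⁺ˡ; ∈-++⁺ʳ; ∈-++⁻)
import Data.List.Relation.Unary.All as All
import Data.List.Relation.Unary.All.Properties as All
open import Data.List.Relation.Unary.Any using (here; there; index; _─_)
open import Data.List.Relation.Unary.Unique.Propositional using (Unique; []; _∷_)
import Data.List.Relation.Unary.Unique.Propositional.Properties as Unique
open import Data.Nat using (ℕ; zero; suc; _+_; _*_; _∸_; _≤_; _<_; _⊔_; z≤n; s≤s; z<s; s≤s⁻¹)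
open import Data.Nat.Properties
open import Algebra.Properties.CommutativeSemigroup +-commutativeSemigroup
  using () renaming (interchange to +-interchange)
open import Data.Product using (Σ-syntax; ∃; ∃-syntax; _×_; _,_; proj₁; proj₂)
open import Data.Sum using (_⊎_; inj₁; inj₂; [_,_])
open import Data.Sum.Properties using (inj₁-injective; inj₂-injective)
open import Data.Unit using (⊤; tt)
open import Function using (_∘_; id)
open import Relation.Binary.Definitions using (Symmetric; tri<; tri≈; tri>)
open import Relation.Binary.PropositionalEquality
  using (_≡_; _≢_; refl; sym; trans; cong; cong₂; subst; module ≡-Reasoning)
open import Relation.Nullary using (¬_; Dec; yes; no; _×-dec_)

private variable
  A B : Set

∈-─⁺ : ∀ {x y : A} {xs} (x∈xs : x ∈ xs) → y ∈ xs → y ≢ x → y ∈ (xs ─ x∈xs)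
∈-─⁺ (here refl) (here refl) y≢x = ⊥-elim (y≢x refl)
∈-─⁺ (here refl) (there y∈xs) _ = y∈xs
∈-─⁺ (there x∈xs) (here refl) _ = here refl
∈-─⁺ (there x∈xs) (there y∈xs) y≢x = there (∈-─⁺ x∈xs y∈xs y≢x)

length-≤-injection : ∀ (f : A → B) {xs ys} → Unique xs → (∀ {x} → x ∈ xs → f x ∈ ys) →
  (∀ {x y} → x ∈ xs → y ∈ xs → f x ≡ f y → x ≡ y) → length xs ≤ length ys
length-≤-injection f {[]} _ _ _ = z≤n
length-≤-injection f {x ∷ xs} {ys} (x∉xs ∷ xs!) into inj =
  subst (suc (length xs) ≤_) (sym (length-removeAt′ ys (index fx∈ys)))
    (s≤s (length-≤-injection f xs! into′ (λ p q → inj (there p) (there q))))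
  where
  fx∈ys = into (here refl)
  into′ : ∀ {y} → y ∈ xs → f y ∈ (ys ─ fx∈ys)
  into′ y∈xs = ∈-─⁺ fx∈ys (into (there y∈xs))
    (λ fy≡fx → All.lookup x∉xs y∈xs (inj (here refl) (there y∈xs) (sym fy≡fx)))

-- HasDegree X v d unfolds to Count (Adj X v) d.
Count : (A → Set) → ℕ → Set
Count {A} P k = Σ[ l ∈ List A ] Unique l × (∀ x → (x ∈ l → P x) × (P x → x ∈ l)) × length l ≡ k

module _ {P : A → Set} {Q : B → Set} where

  Count-≤ : ∀ (f : A → B) {a b} → (∀ {x} → P x → Q (f x)) →
    (∀ {x y} → P x → P y → f x ≡ f y → x ≡ y) → Count P a → Count Q b → a ≤ b
  Count-≤ f into inj (xs , xs! , xs↔P , refl) (ys , _ , ys↔Q , refl) =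
    length-≤-injection f xs! (λ {x} x∈xs → proj₂ (ys↔Q (f x)) (into (proj₁ (xs↔P x) x∈xs)))
      (λ {x} {y} x∈xs y∈xs → inj (proj₁ (xs↔P x) x∈xs) (proj₁ (xs↔P y) y∈xs))

module _ {P : A → Set} where

  Count-mono : ∀ {Q : A → Set} {a b} → (∀ {x} → P x → Q x) → Count P a → Count Q b → a ≤ b
  Count-mono into = Count-≤ id into (λ _ _ → id)

  Count-unique : ∀ {a b} → Count P a → Count P b → a ≡ b
  Count-unique ca cb = ≤-antisym (Count-mono id ca cb) (Count-mono id cb ca)

  Count-dec : ∀ {a} → Count P a → ∀ b → Dec (Count P b)
  Count-dec {a} ca b with b ≟ a
  ... | yes refl = yes ca
  ... | no b≢a = no (λ cb → b≢a (Count-unique cb ca))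

Count-∈ : ∀ {xs : List A} → Unique xs → Count (_∈ xs) (length xs)
Count-∈ xs! = _ , xs! , (λ _ → id , id) , refl

Count-Fin : ∀ k → Count {Fin k} (λ _ → ⊤) k
Count-Fin k = allFin k , Unique.allFin⁺ k , (λ i → (λ _ → tt) , (λ _ → ∈-allFin i)) , length-tabulate id

module _ {P : A → Set} {Q : B → Set} where

  Count-⊎ : ∀ {a b} → Count P a → Count Q b → Count [ P , Q ] (a + b)
  Count-⊎ (xs , xs! , xs↔P , refl) (ys , ys! , ys↔Q , refl) =
    map inj₁ xs ++ map inj₂ ys ,
    Unique.++⁺ (Unique.map⁺ inj₁-injective xs!) (Unique.map⁺ inj₂-injective ys!) disjoint ,
    members ,
    trans (length-++ (map inj₁ xs)) (cong₂ _+_ (length-map inj₁ xs) (length-map inj₂ ys))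
    where
    disjoint : ∀ {z} → ¬ (z ∈ map inj₁ xs × z ∈ map inj₂ ys)
    disjoint (p , q) with ∈-map⁻ inj₁ p | ∈-map⁻ inj₂ q
    ... | _ , _ , refl | _ , _ , ()
    members : ∀ z → (z ∈ map inj₁ xs ++ map inj₂ ys → [ P , Q ] z) ×
                    ([ P , Q ] z → z ∈ map inj₁ xs ++ map inj₂ ys)
    members (inj₁ x) = to , λ px → ∈-++⁺ˡ (∈-map⁺ inj₁ (proj₂ (xs↔P x) px))
      where
      to : inj₁ x ∈ map inj₁ xs ++ map inj₂ ys → P x
      to p with ∈-++⁻ (map inj₁ xs) p
      ... | inj₁ p₁ with ∈-map⁻ inj₁ p₁
      ...   | _ , x∈xs , refl = proj₁ (xs↔P x) x∈xs
      to p | inj₂ p₂ with ∈-map⁻ inj₂ p₂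
      ...   | _ , _ , ()
    members (inj₂ y) = to , λ qy → ∈-++⁺ʳ (map inj₁ xs) (∈-map⁺ inj₂ (proj₂ (ys↔Q y) qy))
      where
      to : inj₂ y ∈ map inj₁ xs ++ map inj₂ ys → Q y
      to p with ∈-++⁻ (map inj₁ xs) p
      ... | inj₁ p₁ with ∈-map⁻ inj₁ p₁
      ...   | _ , _ , ()
      to p | inj₂ p₂ with ∈-map⁻ inj₂ p₂
      ...   | _ , y∈ys , refl = proj₁ (ys↔Q y) y∈ys

Unique-map⁺-on : ∀ (f : A → B) {xs} → (∀ {x y} → x ∈ xs → y ∈ xs → f x ≡ f y → x ≡ y) →
  Unique xs → Unique (map f xs)
Unique-map⁺-on f {[]} _ [] = []
Unique-map⁺-on f {x ∷ xs} inj (x∉xs ∷ xs!) =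
  All.map⁺ (All.tabulate (λ y∈xs fx≡fy → All.lookup x∉xs y∈xs (inj (here refl) (there y∈xs) fx≡fy))) ∷
  Unique-map⁺-on f (λ x∈xs y∈xs → inj (there x∈xs) (there y∈xs)) xs!

module _ {P : A → Set} {Q : B → Set} where

  Count-image : ∀ (f : A → B) {a} → (∀ {x y} → P x → P y → f x ≡ f y → x ≡ y) →
    (∀ {x} → P x → Q (f x)) → (∀ {y} → Q y → ∃[ x ] P x × f x ≡ y) → Count P a → Count Q a
  Count-image f inj into onto (xs , xs! , xs↔P , refl) =
    map f xs ,
    Unique-map⁺-on f (λ {x} {y} x∈xs y∈xs → inj (proj₁ (xs↔P x) x∈xs) (proj₁ (xs↔P y) y∈xs)) xs! ,
    members , length-map f xs
    where
    members : ∀ y → (y ∈ map f xs → Q y) × (Q y → y ∈ map f xs)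
    members y = to , from
      where
      to : y ∈ map f xs → Q y
      to y∈fxs with ∈-map⁻ f y∈fxs
      ... | x , x∈xs , refl = into (proj₁ (xs↔P x) x∈xs)
      from : Q y → y ∈ map f xs
      from qy with onto qy
      ... | x , px , refl = ∈-map⁺ f (proj₂ (xs↔P x) px)

inj₂s : List (A ⊎ B) → List B
inj₂s [] = []
inj₂s (inj₁ _ ∷ zs) = inj₂s zs
inj₂s (inj₂ y ∷ zs) = y ∷ inj₂s zs

∈-inj₂s⁺ : ∀ {y : B} {zs : List (A ⊎ B)} → inj₂ y ∈ zs → y ∈ inj₂s zs
∈-inj₂s⁺ {zs = inj₂ _ ∷ _} (here refl) = here refl
∈-inj₂s⁺ {zs = inj₁ _ ∷ _} (there p) = ∈-inj₂s⁺ p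
∈-inj₂s⁺ {zs = inj₂ _ ∷ _} (there p) = there (∈-inj₂s⁺ p)

∈-inj₂s⁻ : ∀ {y : B} {zs : List (A ⊎ B)} → y ∈ inj₂s zs → inj₂ y ∈ zs
∈-inj₂s⁻ {zs = inj₁ _ ∷ _} p = there (∈-inj₂s⁻ p)
∈-inj₂s⁻ {zs = inj₂ _ ∷ _} (here refl) = here refl
∈-inj₂s⁻ {zs = inj₂ _ ∷ _} (there p) = there (∈-inj₂s⁻ p)

inj₂s-unique : ∀ {zs : List (A ⊎ B)} → Unique zs → Unique (inj₂s zs)
inj₂s-unique {zs = []} [] = []
inj₂s-unique {zs = inj₁ _ ∷ _} (_ ∷ zs!) = inj₂s-unique zs!
inj₂s-unique {zs = inj₂ _ ∷ _} (z∉zs ∷ zs!) =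
  All.tabulate (λ p y≡y′ → All.lookup z∉zs (∈-inj₂s⁻ p) (cong inj₂ y≡y′)) ∷ inj₂s-unique zs!

Count-inj₂ : ∀ {P : A ⊎ B → Set} {a} → Count P a → ∃[ b ] Count (P ∘ inj₂) b
Count-inj₂ (zs , zs! , zs↔P , _) =
  _ , inj₂s zs , inj₂s-unique zs! ,
  (λ y → proj₁ (zs↔P (inj₂ y)) ∘ ∈-inj₂s⁻ , ∈-inj₂s⁺ ∘ proj₂ (zs↔P (inj₂ y))) , refl

module _ {X : Graph} where

  HasDegree-≤-pages : ∀ {k v d} → MBE X k → HasDegree X v d → d ≤ k
  HasDegree-≤-pages {k} {v} m v-deg =
    Count-≤ (MBE.page m v) _ (λ vx vy → MBE.matching m v _ _ vx vy) v-deg (Count-Fin k)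

  maxDegree-attained : ∀ {d} → IsMaxDegree X d → V X → Σ[ v ∈ V X ] HasDegree X v d
  maxDegree-attained (_ , inj₂ attained) _ = attained
  maxDegree-attained (bounded , inj₁ refl) v with bounded v
  ... | _ , v-deg , d≤0 rewrite n≤0⇒n≡0 d≤0 = v , v-deg

  IsMaxDegree⇒degree : ∀ {d} → IsMaxDegree X d → ∀ v → ∃ (HasDegree X v)
  IsMaxDegree⇒degree (bounded , _) v = proj₁ (bounded v) , proj₁ (proj₂ (bounded v))

  IsMaxDegree⇒below : ∀ {d} → IsMaxDegree X d → ∀ v → ¬ HasDegree X v d →
    Σ[ d′ ∈ ℕ ] HasDegree X v d′ × d′ < d
  IsMaxDegree⇒below (bounded , _) v ¬v-deg with bounded v
  ... | d′ , v-deg , d′≤d = d′ , v-deg , ≤∧≢⇒< d′≤d λ { refl → ¬v-deg v-deg }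

  dispersable : ∀ {k} → (∀ v → ∃ (HasDegree X v)) → MBE X k → Σ[ v ∈ V X ] HasDegree X v k →
    Dispersable X
  dispersable {k} degree m (v , v-deg) =
    k , ((λ u → proj₁ (degree u) , proj₂ (degree u) , HasDegree-≤-pages m (proj₂ (degree u))) ,
         inj₂ (v , v-deg)) ,
    m , λ _ m′ → HasDegree-≤-pages m′ v-deg

  dispersable-empty : ¬ V X → Dispersable X
  dispersable-empty ¬v = 0 , ((λ v → ⊥-elim (¬v v)) , inj₁ refl) , empty , λ _ _ → z≤n
    where
    empty : MBE X 0
    empty = record
      { pos = λ v → ⊥-elim (¬v v) ; pos-inj = λ {v} _ → ⊥-elim (¬v v)
      ; page = λ v _ → ⊥-elim (¬v v) ; page-sym = λ v _ _ → ⊥-elim (¬v v)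
      ; matching = λ v _ _ _ _ _ → ⊥-elim (¬v v) ; noCross = λ v _ _ _ _ _ _ _ → ⊥-elim (¬v v) }

module _ {X : Graph} {k : ℕ} where
  open MBE

  MBE-inject : MBE X k → ∀ m → MBE X (k + m)
  MBE-inject e m = record
    { pos = pos e ; pos-inj = pos-inj e ; page = λ u v → page e u v ↑ˡ m
    ; page-sym = λ u v uv → cong (_↑ˡ m) (page-sym e u v uv)
    ; matching = λ u v w uv uw eq → matching e u v w uv uw (Fin.↑ˡ-injective m _ _ eq)
    ; noCross = λ u v x y uv xy eq → noCross e u v x y uv xy (Fin.↑ˡ-injective m _ _ eq) }

  Unjumped : MBE X k → V X → Fin k → Set
  Unjumped e w p = ∀ {a b} → Adj X a b → page e a b ≡ p → ¬ (pos e a < pos e w × pos e w < pos e b)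

  module _ (Adj-sym : Symmetric (Adj X)) (e : MBE X k) where

    page-flip : ∀ {u v x y} → Adj X u v → Adj X x y → page e u v ≡ page e x y → page e v u ≡ page e y x
    page-flip uv xy eq = trans (sym (page-sym e _ _ uv)) (trans eq (page-sym e _ _ xy))

    noCross-≤ : ∀ {u v x y} → Adj X u v → Adj X x y → page e u v ≡ page e x y →
      pos e u ≤ pos e x → pos e x ≤ pos e v → pos e v ≤ pos e y → u ≡ x × v ≡ y
    noCross-≤ {u} {v} {x} {y} uv xy eq u≤x x≤v v≤y
      with m≤n⇒m<n∨m≡n u≤x | m≤n⇒m<n∨m≡n x≤v | m≤n⇒m<n∨m≡n v≤y
    ... | inj₂ u≡x | _ | _ with pos-inj e u≡x
    ...   | refl = refl , matching e u v y uv xy eq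
    noCross-≤ {u} {v} {x} {y} uv xy eq u≤x x≤v v≤y | inj₁ u<x | inj₂ x≡v | _ with pos-inj e x≡v
    ...   | refl = ⊥-elim (<-irrefl (cong (pos e) u≡y) (<-≤-trans u<x v≤y))
      where
      u≡y : u ≡ y
      u≡y = matching e x u y (Adj-sym uv) xy (trans (sym (page-sym e u x uv)) eq)
    noCross-≤ {u} {v} {x} {y} uv xy eq u≤x x≤v v≤y | inj₁ u<x | inj₁ x<v | inj₂ v≡y with pos-inj e v≡y
    ...   | refl = matching e v u x (Adj-sym uv) (Adj-sym xy) (page-flip uv xy eq) , refl
    noCross-≤ uv xy eq u≤x x≤v v≤y | inj₁ u<x | inj₁ x<v | inj₁ v<y =
      ⊥-elim (noCross e _ _ _ _ uv xy eq (u<x , x<v , v<y))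

    module Mirror (M : ℕ) (pos<M : ∀ v → pos e v < M) where

      ∸-suc-reflects-< : ∀ {p q} → M ∸ suc p < M ∸ suc q → q < p
      ∸-suc-reflects-< lt = ≰⇒> (λ p≤q → <⇒≱ lt (∸-monoʳ-≤ M (s≤s p≤q)))

      mirror : MBE X k
      mirror = record
        { pos = λ v → M ∸ suc (pos e v)
        ; pos-inj = λ {u} {v} eq → pos-inj e (suc-injective (∸-cancelˡ-≡ (pos<M u) (pos<M v) eq))
        ; page = page e ; page-sym = page-sym e ; matching = matching e
        ; noCross = λ u v x y uv xy eq (u<x , x<v , v<y) →
            noCross e y x v u (Adj-sym xy) (Adj-sym uv) (page-flip xy uv (sym eq))
              (∸-suc-reflects-< v<y , ∸-suc-reflects-< x<v , ∸-suc-reflects-< u<x) }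

      mirror-Unjumped : ∀ {w p} → Unjumped e w p → Unjumped mirror w p
      mirror-Unjumped unjumped ab eq (a<w , w<b) =
        unjumped (Adj-sym ab) (trans (sym (page-sym e _ _ ab)) eq)
          (∸-suc-reflects-< w<b , ∸-suc-reflects-< a<w)

toGraph-sym : ∀ H → Symmetric (Adj (toGraph H))
toGraph-sym H {h} {g} hg = trans (SimpleGraph.sym H g h) hg

adj⇒≢ : ∀ H {h g} → adj H h g ≡ true → h ≢ g
adj⇒≢ H {h} hh refl with trans (sym (irrefl H h)) hh
... | ()

FAdj-sym : ∀ F G → Symmetric (FAdj F G)
FAdj-sym S G {inj₁ _} {inj₂ _} ue = ue
FAdj-sym S G {inj₂ _} {inj₁ _} eu = eu
FAdj-sym R G {inj₁ _} {inj₁ _} uv = toGraph-sym G uv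
FAdj-sym R G {inj₁ _} {inj₂ _} ue = ue
FAdj-sym R G {inj₂ _} {inj₁ _} eu = eu
FAdj-sym T G {inj₁ _} {inj₁ _} uv = toGraph-sym G uv
FAdj-sym T G {inj₁ _} {inj₂ _} ue = ue
FAdj-sym T G {inj₂ _} {inj₁ _} eu = eu
FAdj-sym T G {inj₂ _} {inj₂ _} (distinct , v , ve , vf) = flip distinct , v , vf , ve
  where
  flip : ∀ {a b c d : Fin (n G)} → a ≢ b ⊎ c ≢ d → b ≢ a ⊎ d ≢ c
  flip (inj₁ a≢b) = inj₁ (a≢b ∘ sym)
  flip (inj₂ c≢d) = inj₂ (c≢d ∘ sym)

module _ {M : ℕ} where

  block-< : ∀ {a b r} s → r < M → a < b → a * M + r < b * M + s
  block-< {a} {b} {r} s r<M a<b = begin-strict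
    a * M + r   <⟨ +-monoʳ-< (a * M) r<M ⟩
    a * M + M   ≡⟨ +-comm (a * M) M ⟩
    suc a * M   ≤⟨ *-monoˡ-≤ M a<b ⟩
    b * M       ≤⟨ m≤m+n (b * M) s ⟩
    b * M + s   ∎
    where open ≤-Reasoning

  block-≤ : ∀ {a b r s} → s < M → a * M + r < b * M + s → a ≤ b
  block-≤ {r = r} s<M lt = ≮⇒≥ (λ b<a → <-asym lt (block-< r s<M b<a))

  block-injective : ∀ {a b r s} → r < M → s < M → a * M + r ≡ b * M + s → a ≡ b × r ≡ s
  block-injective {a} {b} {r} {s} r<M s<M eq with <-cmp a b
  ... | tri< a<b _ _ = ⊥-elim (<-irrefl eq (block-< s r<M a<b))
  ... | tri> _ _ b<a = ⊥-elim (<-irrefl (sym eq) (block-< r s<M b<a))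
  ... | tri≈ _ refl _ = refl , +-cancelˡ-≡ (a * M) r s eq

-- σ x q is the page of the copies at x of the H-edges on page q of eH; only its values at original
-- vertices matter.
module Product (F : Op) (G H : SimpleGraph) (colouring : Bipartite H) {dH d : ℕ}
  (eH : MBE (toGraph H) dH) (eX : MBE (FG F G) d) (M : ℕ) (pos<M : ∀ x → MBE.pos eX x < M)
  (σ : FV G → Fin dH → Fin d)
  (σ-injective : ∀ {w w′ q q′} → σ (inj₁ w) q ≡ σ (inj₁ w′) q′ → q ≡ q′)
  (σ-fresh : ∀ {w y} q → FAdj F G (inj₁ w) y → MBE.page eX (inj₁ w) y ≢ σ (inj₁ w) q)
  (σ-Unjumped : ∀ w q → Unjumped eX (inj₁ w) (σ (inj₁ w) q))
  where

  open MBE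
  open Mirror (FAdj-sym F G) eX M pos<M

  colour = proj₁ colouring
  Sum = FSum F G H

  layer : Bool → MBE (FG F G) d
  layer false = eX
  layer true = mirror

  layer-Unjumped : ∀ b w q → Unjumped (layer b) (inj₁ w) (σ (inj₁ w) q)
  layer-Unjumped false w q = σ-Unjumped w q
  layer-Unjumped true w q = mirror-Unjumped (σ-Unjumped w q)

  layers-opposite : ∀ {b b′ x y} → b ≢ b′ → pos (layer b) x < pos (layer b) y →
    ¬ pos (layer b′) x < pos (layer b′) y
  layers-opposite {false} {false} b≢b′ = ⊥-elim (b≢b′ refl)
  layers-opposite {false} {true} _ x<y x>y = <-asym x<y (∸-suc-reflects-< x>y)
  layers-opposite {true} {false} _ x>y x<y = <-asym x<y (∸-suc-reflects-< x>y)
  layers-opposite {true} {true} b≢b′ = ⊥-elim (b≢b′ refl)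

  offset : Fin (n H) → FV G → ℕ
  offset h = pos (layer (colour h))

  offset<M : ∀ h x → offset h x < M
  offset<M h x with colour h
  ... | false = pos<M x
  ... | true = ∸-monoʳ-< z<s (pos<M x)

  position : V Sum → ℕ
  position (x , h) = pos eH h * M + offset h x

  position-injective : ∀ {u v} → position u ≡ position v → u ≡ v
  position-injective {x , h} {y , g} eq with block-injective (offset<M h x) (offset<M g y) eq
  ... | same-block , same-offset with pos-inj eH same-block
  ...   | refl with pos-inj (layer (colour h)) same-offset
  ...     | refl = refl

  block-mono : ∀ {x y h g} → position (x , h) < position (y , g) → pos eH h ≤ pos eH g
  block-mono {y = y} {g = g} = block-≤ (offset<M g y)

  block-between : ∀ {x y z h g} → position (x , h) < position (y , g) → position (y , g) < position (z , h) →
    g ≡ h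
  block-between x<y y<z = pos-inj eH (≤-antisym (block-mono y<z) (block-mono x<y))

  offset-mono : ∀ {x y h} → position (x , h) < position (y , h) → offset h x < offset h y
  offset-mono {x} {y} {h} = +-cancelˡ-< (pos eH h * M) (offset h x) (offset h y)

  sumPage : V Sum → V Sum → Fin d
  sumPage (x , h) (y , g) with h Fin.≟ g
  ... | yes _ = page eX x y
  ... | no _ = σ x (page eH h g)

  sumPage-F : ∀ x y h → sumPage (x , h) (y , h) ≡ page eX x y
  sumPage-F x y h with h Fin.≟ h
  ... | yes _ = refl
  ... | no h≢h = ⊥-elim (h≢h refl)

  sumPage-layer : ∀ b x y h → sumPage (x , h) (y , h) ≡ page (layer b) x y
  sumPage-layer false x y h = sumPage-F x y h
  sumPage-layer true x y h = sumPage-F x y h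

  sumPage-H : ∀ x y {h g} → adj H h g ≡ true → sumPage (x , h) (y , g) ≡ σ x (page eH h g)
  sumPage-H x y {h} {g} hg with h Fin.≟ g
  ... | yes h≡g = ⊥-elim (adj⇒≢ H hg h≡g)
  ... | no _ = refl

  sumPage-sym : ∀ u v → Adj Sum u v → sumPage u v ≡ sumPage v u
  sumPage-sym (x , h) (y , _) (inj₂ (refl , xy)) = begin
    sumPage (x , h) (y , h)   ≡⟨ sumPage-F x y h ⟩
    page eX x y               ≡⟨ page-sym eX x y xy ⟩
    page eX y x               ≡⟨ sumPage-F y x h ⟨
    sumPage (y , h) (x , h)   ∎
    where open ≡-Reasoning
  sumPage-sym (x , h) (_ , g) (inj₁ (_ , refl , refl , hg)) = begin
    sumPage (x , h) (x , g)   ≡⟨ sumPage-H x x hg ⟩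
    σ x (page eH h g)         ≡⟨ cong (σ x) (page-sym eH h g hg) ⟩
    σ x (page eH g h)         ≡⟨ sumPage-H x x (toGraph-sym H hg) ⟨
    sumPage (x , g) (x , h)   ∎
    where open ≡-Reasoning

  sumPage-matching : ∀ u v z → Adj Sum u v → Adj Sum u z → sumPage u v ≡ sumPage u z → v ≡ z
  sumPage-matching (x , h) (y , _) (z , _) (inj₂ (refl , xy)) (inj₂ (refl , xz)) eq =
    cong (_, h) (matching eX x y z xy xz (trans (sym (sumPage-F x y h)) (trans eq (sumPage-F x z h))))
  sumPage-matching (x , h) (_ , g) (_ , g′) (inj₁ (w , refl , refl , hg)) (inj₁ (_ , refl , refl , hg′)) eq =
    cong (x ,_) (matching eH h g g′ hg hg′
      (σ-injective (trans (sym (sumPage-H x x hg)) (trans eq (sumPage-H x x hg′)))))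
  sumPage-matching (x , h) (y , _) _ (inj₂ (refl , xy)) (inj₁ (w , refl , refl , hg′)) eq =
    ⊥-elim (σ-fresh _ xy (trans (sym (sumPage-F x y h)) (trans eq (sumPage-H x x hg′))))
  sumPage-matching (x , h) _ (z , _) (inj₁ (w , refl , refl , hg)) (inj₂ (refl , xz)) eq =
    ⊥-elim (σ-fresh _ xz (trans (sym (sumPage-F x z h)) (trans (sym eq) (sumPage-H x x hg))))

  sumPage-noCross : ∀ u v x y → Adj Sum u v → Adj Sum x y → sumPage u v ≡ sumPage x y →
    ¬ (position u < position x × position x < position v × position v < position y)
  sumPage-noCross (a , h) (b , _) (c , _) (e , _) (inj₂ (refl , ab)) (inj₂ (refl , ce)) eq (a<c , c<b , b<e)
    with block-between a<c c<b
  ... | refl = noCross (layer (colour h)) a b c e ab ce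
                 (trans (sym (sumPage-layer (colour h) a b h)) (trans eq (sumPage-layer (colour h) c e h)))
                 (offset-mono a<c , offset-mono c<b , offset-mono b<e)
  sumPage-noCross (a , h) (b , _) (x , _) (_ , g) (inj₂ (refl , ab)) (inj₁ (w , refl , refl , hg)) eq
    (a<x , x<b , _)
    with block-between a<x x<b
  ... | refl = layer-Unjumped (colour h) w (page eH h g) ab
                 (trans (sym (sumPage-layer (colour h) a b h)) (trans eq (sumPage-H x x hg)))
                 (offset-mono a<x , offset-mono x<b)
  sumPage-noCross (x , h) (_ , g) (a , _) (b , _) (inj₁ (w , refl , refl , hg)) (inj₂ (refl , ab)) eq
    (_ , a<x , x<b)
    with block-between a<x x<b
  ... | refl = layer-Unjumped (colour g) w (page eH h g) ab
                 (trans (sym (sumPage-layer (colour g) a b g)) (trans (sym eq) (sumPage-H x x hg)))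
                 (offset-mono a<x , offset-mono x<b)
  sumPage-noCross (x , h) (_ , g) (x′ , _) _ (inj₁ (_ , refl , refl , hg)) (inj₁ (_ , refl , refl , h′g′)) eq
    (l₁ , l₂ , l₃)
    with noCross-≤ (toGraph-sym H) eH hg h′g′
           (σ-injective (trans (sym (sumPage-H x x hg)) (trans eq (sumPage-H x′ x′ h′g′))))
           (block-mono l₁) (block-mono l₂) (block-mono l₃)
  -- two crossing copies of the same H-edge hg would meet x and x′ in the same order in the blocks of h and g
  ... | refl , refl = layers-opposite (proj₂ colouring h g hg) (offset-mono l₁) (offset-mono l₃)

  embedding : MBE Sum d
  embedding = record
    { pos = position ; pos-inj = position-injective ; page = sumPage ; page-sym = sumPage-sym
    ; matching = sumPage-matching ; noCross = sumPage-noCross }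

↑ˡ≢↑ʳ : ∀ {m k} {i : Fin m} {j : Fin k} → i ↑ˡ k ≢ m ↑ʳ j
↑ˡ≢↑ʳ {m} {k} {i} {j} eq
  with trans (sym (Fin.splitAt-↑ˡ m i k)) (trans (cong (splitAt m) eq) (Fin.splitAt-↑ʳ m k j))
... | ()

Fin-bounded : ∀ {k} (f : Fin k → ℕ) → Σ[ M ∈ ℕ ] (∀ i → f i < M)
Fin-bounded {zero} f = 0 , λ ()
Fin-bounded {suc k} f with Fin-bounded (f ∘ suc)
... | M , f<M = suc (f zero) ⊔ M , bound
  where
  bound : ∀ i → f i < suc (f zero) ⊔ M
  bound zero = m≤m⊔n (suc (f zero)) M
  bound (suc i) = <-≤-trans (f<M i) (m≤n⊔m (suc (f zero)) M)

module _ {G : SimpleGraph} where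

  Edge-≡ : ∀ {e f : Edge G} → src {G} e ≡ src {G} f → tgt {G} e ≡ tgt {G} f → e ≡ f
  Edge-≡ {i , j , i<j , ij} {_ , _ , i<j′ , ij′} refl refl
    rewrite Fin.<-irrelevant i<j i<j′ | Decidable⇒UIP.≡-irrelevant Bool._≟_ ij ij′ = refl

  _≟ᴱ_ : (e f : Edge G) → Dec (e ≡ f)
  e ≟ᴱ f with src {G} e Fin.≟ src {G} f | tgt {G} e Fin.≟ tgt {G} f
  ... | yes s≡s | yes t≡t = yes (Edge-≡ s≡s t≡t)
  ... | no s≢s | _ = no (s≢s ∘ cong (src {G}))
  ... | yes _ | no t≢t = no (t≢t ∘ cong (tgt {G}))

  edgeValue : (Edge G → ℕ) → Fin (n G) → Fin (n G) → ℕ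
  edgeValue f i j with i Fin.<? j | adj G i j Bool.≟ true
  ... | yes i<j | yes ij = f (i , j , i<j , ij)
  ... | _ | _ = 0

  edgeValue-edge : ∀ f (e : Edge G) → edgeValue f (src {G} e) (tgt {G} e) ≡ f e
  edgeValue-edge f (i , j , i<j , ij) with i Fin.<? j | adj G i j Bool.≟ true
  ... | yes i<j′ | yes ij′ = cong f (Edge-≡ refl refl)
  ... | no i≮j | _ = ⊥-elim (i≮j i<j)
  ... | yes _ | no ¬ij = ⊥-elim (¬ij ij)

  FV-bounded : (f : FV G → ℕ) → Σ[ M ∈ ℕ ] (∀ x → f x < M)
  FV-bounded f = Mᵥ ⊔ Mₑ , bound
    where
    vertexBound = Fin-bounded (f ∘ inj₁)
    rowBound = λ i → Fin-bounded (edgeValue (f ∘ inj₂) i)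
    edgeBound = Fin-bounded (proj₁ ∘ rowBound)
    Mᵥ = proj₁ vertexBound
    Mₑ = proj₁ edgeBound
    bound : ∀ x → f x < Mᵥ ⊔ Mₑ
    bound (inj₁ v) = <-≤-trans (proj₂ vertexBound v) (m≤m⊔n Mᵥ Mₑ)
    bound (inj₂ e@(i , j , _)) = begin-strict
      f (inj₂ e)                  ≡⟨ edgeValue-edge (f ∘ inj₂) e ⟨
      edgeValue (f ∘ inj₂) i j    <⟨ proj₂ (rowBound i) j ⟩
      proj₁ (rowBound i)          <⟨ proj₂ edgeBound i ⟩
      Mₑ                          ≤⟨ m≤n⊔m Mᵥ Mₑ ⟩
      Mᵥ ⊔ Mₑ                     ∎
      where open ≤-Reasoning

FSum-embedding : ∀ F G H → Bipartite H → ∀ {dH dF} →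
  MBE (toGraph H) dH → MBE (FG F G) dF → MBE (FSum F G H) (dF + dH)
FSum-embedding F G H colouring {dH} {dF} eH eF =
  Product.embedding F G H colouring eH (MBE-inject eF dH) M pos<M (λ _ q → dF ↑ʳ q)
    (Fin.↑ʳ-injective dF _ _) (λ _ _ → ↑ˡ≢↑ʳ) (λ _ _ _ eq _ → ↑ˡ≢↑ʳ eq)
  where
  M = proj₁ (FV-bounded {G} (MBE.pos eF))
  pos<M = proj₂ (FV-bounded {G} (MBE.pos eF))

module _ (F : Op) (G H : SimpleGraph) where

  FSum-degree-vertex : ∀ {w h a b} → HasDegree (FG F G) (inj₁ w) a → HasDegree (toGraph H) h b →
    HasDegree (FSum F G H) (inj₁ w , h) (a + b)
  FSum-degree-vertex {w} {h} degF degH =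
    Count-image neighbour injective (λ {x} → into {x}) onto (Count-⊎ degF degH)
    where
    neighbour : FV G ⊎ Fin (n H) → V (FSum F G H)
    neighbour = [ (_, h) , (inj₁ w ,_) ]
    injective : ∀ {x y} → [ FAdj F G (inj₁ w) , Adj (toGraph H) h ] x →
      [ FAdj F G (inj₁ w) , Adj (toGraph H) h ] y → neighbour x ≡ neighbour y → x ≡ y
    injective {inj₁ _} {inj₁ _} _ _ refl = refl
    injective {inj₂ _} {inj₂ _} _ _ refl = refl
    injective {inj₁ _} {inj₂ _} _ hg refl = ⊥-elim (adj⇒≢ H hg refl)
    injective {inj₂ _} {inj₁ _} hg _ refl = ⊥-elim (adj⇒≢ H hg refl)
    into : ∀ {x} → [ FAdj F G (inj₁ w) , Adj (toGraph H) h ] x → Adj (FSum F G H) (inj₁ w , h) (neighbour x)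
    into {inj₁ _} wy = inj₂ (refl , wy)
    into {inj₂ _} hg = inj₁ (w , refl , refl , hg)
    onto : ∀ {v} → Adj (FSum F G H) (inj₁ w , h) v →
      ∃[ x ] [ FAdj F G (inj₁ w) , Adj (toGraph H) h ] x × neighbour x ≡ v
    onto (inj₁ (_ , refl , refl , hg)) = inj₂ _ , hg , refl
    onto (inj₂ (refl , wy)) = inj₁ _ , wy , refl

  FSum-degree-edge : ∀ {e h a} → HasDegree (FG F G) (inj₂ e) a → HasDegree (FSum F G H) (inj₂ e , h) a
  FSum-degree-edge {e} {h} = Count-image (_, h) (λ _ _ → cong proj₁) (λ ey → inj₂ (refl , ey)) onto
    where
    onto : ∀ {v} → Adj (FSum F G H) (inj₂ e , h) v → ∃[ y ] FAdj F G (inj₂ e) y × (y , h) ≡ v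
    onto (inj₁ (_ , () , _))
    onto (inj₂ (refl , ey)) = _ , ey , refl

  FSum-degrees : (∀ x → ∃ (HasDegree (FG F G) x)) → (∀ h → ∃ (HasDegree (toGraph H) h)) →
    ∀ v → ∃ (HasDegree (FSum F G H) v)
  FSum-degrees degF degH (inj₁ w , h) = _ , FSum-degree-vertex (proj₂ (degF (inj₁ w))) (proj₂ (degH h))
  FSum-degrees degF degH (inj₂ e , h) = _ , FSum-degree-edge (proj₂ (degF (inj₂ e)))

IsMatching : SimpleGraph → Set
IsMatching G = ∀ {v} {e f : Edge G} → Incident {G} v e → Incident {G} v f → e ≡ f

pair-unique : ∀ {a b : A} → a ≢ b → Unique (a ∷ b ∷ [])
pair-unique a≢b = (a≢b All.∷ All.[]) ∷ All.[] ∷ []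

module _ {G : SimpleGraph} where

  src≢tgt : ∀ (e : Edge G) → src {G} e ≢ tgt {G} e
  src≢tgt (_ , _ , i<j , _) i≡j = Fin.<-irrefl i≡j i<j

  endpoints : Edge G → List (FV G)
  endpoints e = inj₁ (src {G} e) ∷ inj₁ (tgt {G} e) ∷ []

  endpoints-unique : ∀ e → Unique (endpoints e)
  endpoints-unique e = pair-unique (src≢tgt e ∘ inj₁-injective)

  Incident⇒∈endpoints : ∀ {u} e → Incident {G} u e → inj₁ u ∈ endpoints e
  Incident⇒∈endpoints _ (inj₁ refl) = here refl
  Incident⇒∈endpoints _ (inj₂ refl) = there (here refl)

  S-degree-edge≤2 : ∀ {e d} → HasDegree (FG S G) (inj₂ e) d → d ≤ 2
  S-degree-edge≤2 {e} e-deg = Count-mono into e-deg (Count-∈ (endpoints-unique e))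
    where
    into : ∀ {x} → FAdj S G (inj₂ e) x → x ∈ endpoints e
    into {inj₁ _} ue = Incident⇒∈endpoints e ue

  R-degree-edge≤src : ∀ {e a b} → HasDegree (FG R G) (inj₂ e) a → HasDegree (FG R G) (inj₁ (src {G} e)) b →
    a ≤ b
  R-degree-edge≤src {e} e-deg src-deg = ≤-trans
    (Count-mono into e-deg (Count-∈ (endpoints-unique e)))
    (Count-mono from (Count-∈ (pair-unique {a = inj₁ (tgt {G} e)} {b = inj₂ e} λ ())) src-deg)
    where
    into : ∀ {x} → FAdj R G (inj₂ e) x → x ∈ endpoints e
    into {inj₁ _} ue = Incident⇒∈endpoints e ue
    from : ∀ {x} → x ∈ inj₁ (tgt {G} e) ∷ inj₂ e ∷ [] → FAdj R G (inj₁ (src {G} e)) x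
    from (here refl) = proj₂ (proj₂ (proj₂ e))
    from (there (here refl)) = inj₁ refl

  S-degrees<2⇒matching : (∀ v → Σ[ d ∈ ℕ ] HasDegree (FG S G) (inj₁ v) d × d < 2) → IsMatching G
  S-degrees<2⇒matching degree {v} {e} {f} ve vf with _≟ᴱ_ {G} e f
  ... | yes e≡f = e≡f
  ... | no e≢f = ⊥-elim (<⇒≱ d<2 (Count-mono from (Count-∈ (pair-unique (e≢f ∘ inj₂-injective))) v-deg))
    where
    v-deg = proj₁ (proj₂ (degree v))
    d<2 = proj₂ (proj₂ (degree v))
    from : ∀ {x} → x ∈ inj₂ e ∷ inj₂ f ∷ [] → FAdj S G (inj₁ v) x
    from (here refl) = ve
    from (there (here refl)) = vf

  matching⇒S-degree-src : IsMatching G → ∀ e → HasDegree (FG S G) (inj₁ (src {G} e)) 1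
  matching⇒S-degree-src matching e = inj₂ e ∷ [] , All.[] ∷ [] , members , refl
    where
    members : ∀ x → (x ∈ inj₂ e ∷ [] → FAdj S G (inj₁ (src {G} e)) x) ×
                    (FAdj S G (inj₁ (src {G} e)) x → x ∈ inj₂ e ∷ [])
    members (inj₁ _) = (λ { (here ()) ; (there ()) }) , λ ()
    members (inj₂ f) = (λ { (here refl) → inj₁ refl }) , λ ef → here (cong inj₂ (matching ef (inj₁ refl)))

module _ {G : SimpleGraph} where

  Incident? : ∀ v (g : Edge G) → Dec (Incident {G} v g)
  Incident? v g with v Fin.≟ src {G} g | v Fin.≟ tgt {G} g
  ... | yes v≡s | _ = yes (inj₁ v≡s)
  ... | no _ | yes v≡t = yes (inj₂ v≡t)
  ... | no v≢s | no v≢t = no [ v≢s , v≢t ]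

  Incident-¬src⇒tgt : ∀ {v} g → Incident {G} v g → v ≢ src {G} g → v ≡ tgt {G} g
  Incident-¬src⇒tgt _ (inj₁ v≡s) v≢s = ⊥-elim (v≢s v≡s)
  Incident-¬src⇒tgt _ (inj₂ v≡t) _ = v≡t

  other : Fin (n G) → Edge G → Fin (n G)
  other v g with v Fin.≟ src {G} g
  ... | yes _ = tgt {G} g
  ... | no _ = src {G} g

  other-adjacent : ∀ {v} g → Incident {G} v g → adj G v (other v g) ≡ true
  other-adjacent {v} g@(_ , _ , _ , st) vg with v Fin.≟ src {G} g
  ... | yes refl = st
  ... | no v≢s rewrite Incident-¬src⇒tgt g vg v≢s = toGraph-sym G st

  reversed-edges : ∀ (g g′ : Edge G) → src {G} g ≡ tgt {G} g′ → tgt {G} g ≡ src {G} g′ → ⊥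
  reversed-edges (_ , _ , s<t , _) (_ , _ , s′<t′ , _) refl refl = Fin.<-asym s<t s′<t′

  other-injective : ∀ {v} g g′ → Incident {G} v g → Incident {G} v g′ → other v g ≡ other v g′ → g ≡ g′
  other-injective {v} g g′ vg vg′ eq with v Fin.≟ src {G} g | v Fin.≟ src {G} g′
  ... | yes v≡s | yes v≡s′ = Edge-≡ {G} (trans (sym v≡s) v≡s′) eq
  ... | no v≢s | no v≢s′ =
    Edge-≡ {G} eq (trans (sym (Incident-¬src⇒tgt g vg v≢s)) (Incident-¬src⇒tgt g′ vg′ v≢s′))
  ... | yes v≡s | no v≢s′ =
    ⊥-elim (reversed-edges g g′ (trans (sym v≡s) (Incident-¬src⇒tgt g′ vg′ v≢s′)) eq)
  ... | no v≢s | yes v≡s′ =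
    ⊥-elim (reversed-edges g′ g (trans (sym v≡s′) (Incident-¬src⇒tgt g vg v≢s)) (sym eq))

  T-degree-vertex : ∀ {v r d} → Count (Incident {G} v) r → HasDegree (FG T G) (inj₁ v) d → r + r ≤ d
  T-degree-vertex {v} incident v-deg =
    Count-≤ [ inj₂ , inj₁ ∘ other v ] (λ {x} → into {x}) injective (Count-⊎ incident incident) v-deg
    where
    into : ∀ {x} → [ Incident {G} v , Incident {G} v ] x → FAdj T G (inj₁ v) ([ inj₂ , inj₁ ∘ other v ] x)
    into {inj₁ _} vg = vg
    into {inj₂ g} vg = other-adjacent g vg
    injective : ∀ {x y} → [ Incident {G} v , Incident {G} v ] x → [ Incident {G} v , Incident {G} v ] y →
      [ inj₂ , inj₁ ∘ other v ] x ≡ [ inj₂ , inj₁ ∘ other v ] y → x ≡ y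
    injective {inj₁ _} {inj₁ _} _ _ refl = refl
    injective {inj₂ g} {inj₂ g′} vg vg′ eq = cong inj₂ (other-injective g g′ vg vg′ (inj₁-injective eq))
    injective {inj₁ _} {inj₂ _} _ _ ()
    injective {inj₂ _} {inj₁ _} _ _ ()

  T-degree-edge : ∀ {e r s d} → Count (Incident {G} (src {G} e)) r → Count (Incident {G} (tgt {G} e)) s →
    HasDegree (FG T G) (inj₂ e) d → d ≤ r + s
  T-degree-edge {e} countᵢ countⱼ e-deg =
    Count-≤ sided (λ {x} → into {x}) injective e-deg (Count-⊎ countᵢ countⱼ)
    where
    i = src {G} e
    j = tgt {G} e
    onSide : ∀ {P : Set} → Dec P → Edge G → Edge G ⊎ Edge G
    onSide (yes _) = inj₁
    onSide (no _) = inj₂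
    sided : FV G → Edge G ⊎ Edge G
    sided (inj₁ u) = onSide (u Fin.≟ i) e
    sided (inj₂ g) = onSide (Incident? i g) g
    edgeOf : FV G → Edge G
    edgeOf (inj₁ _) = e
    edgeOf (inj₂ g) = g
    forget-onSide : ∀ {P : Set} (p? : Dec P) g → [ id , id ] (onSide p? g) ≡ g
    forget-onSide (yes _) g = refl
    forget-onSide (no _) g = refl
    sided-edgeOf : ∀ {x y} → sided x ≡ sided y → edgeOf x ≡ edgeOf y
    sided-edgeOf {x} {y} eq = trans (sym (forget x)) (trans (cong [ id , id ] eq) (forget y))
      where
      forget : ∀ x → [ id , id ] (sided x) ≡ edgeOf x
      forget (inj₁ u) = forget-onSide (u Fin.≟ i) e
      forget (inj₂ g) = forget-onSide (Incident? i g) g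
    distinct⇒≢ : ∀ {g} → src {G} e ≢ src {G} g ⊎ tgt {G} e ≢ tgt {G} g → e ≢ g
    distinct⇒≢ (inj₁ s≢s) refl = s≢s refl
    distinct⇒≢ (inj₂ t≢t) refl = t≢t refl
    into : ∀ {x} → FAdj T G (inj₂ e) x → [ Incident {G} i , Incident {G} j ] (sided x)
    into {inj₁ u} _ with u Fin.≟ i
    ... | yes _ = inj₁ refl
    ... | no _ = inj₂ refl
    into {inj₂ g} (_ , v , ve , vg) with Incident? i g
    ... | yes ig = ig
    ... | no ¬ig = subst (λ w → Incident {G} w g) (Incident-¬src⇒tgt e ve λ { refl → ¬ig vg }) vg
    injective : ∀ {x y} → FAdj T G (inj₂ e) x → FAdj T G (inj₂ e) y → sided x ≡ sided y → x ≡ y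
    injective {inj₁ u} {inj₁ u′} ue ue′ eq with u Fin.≟ i | u′ Fin.≟ i
    ... | yes u≡i | yes u′≡i = cong inj₁ (trans u≡i (sym u′≡i))
    ... | no u≢i | no u′≢i =
      cong inj₁ (trans (Incident-¬src⇒tgt e ue u≢i) (sym (Incident-¬src⇒tgt e ue′ u′≢i)))
    injective {inj₁ u} {inj₁ u′} ue ue′ () | yes _ | no _
    injective {inj₁ u} {inj₁ u′} ue ue′ () | no _ | yes _
    injective {inj₂ g} {inj₂ g′} _ _ eq = cong inj₂ (sided-edgeOf {inj₂ g} {inj₂ g′} eq)
    injective {inj₁ u} {inj₂ g} _ (distinct , _) eq =
      ⊥-elim (distinct⇒≢ distinct (sided-edgeOf {inj₁ u} {inj₂ g} eq))
    injective {inj₂ g} {inj₁ u} (distinct , _) _ eq =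
      ⊥-elim (distinct⇒≢ distinct (sided-edgeOf {inj₁ u} {inj₂ g} (sym eq)))

  T-degree-edge-double : ∀ {e a b c} → HasDegree (FG T G) (inj₂ e) a →
    HasDegree (FG T G) (inj₁ (src {G} e)) b → HasDegree (FG T G) (inj₁ (tgt {G} e)) c → a + a ≤ b + c
  T-degree-edge-double {e} {a} e-deg src-deg tgt-deg with Count-inj₂ src-deg | Count-inj₂ tgt-deg
  ... | r , countᵢ | s , countⱼ = begin
    a + a               ≤⟨ +-mono-≤ a≤r+s a≤r+s ⟩
    (r + s) + (r + s)   ≡⟨ +-interchange r s r s ⟩
    (r + r) + (s + s)   ≤⟨ +-mono-≤ (T-degree-vertex countᵢ src-deg) (T-degree-vertex countⱼ tgt-deg) ⟩
    _                   ∎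
    where
    open ≤-Reasoning
    a≤r+s = T-degree-edge countᵢ countⱼ e-deg

Consecutive : ℕ → ℕ → Set
Consecutive p q = q ≡ suc p ⊎ p ≡ suc q

Consecutive-¬between : ∀ {p q r} → Consecutive p q → ¬ (p < r × r < q)
Consecutive-¬between (inj₁ refl) (p<r , r<p+1) = <-irrefl refl (<-≤-trans p<r (s≤s⁻¹ r<p+1))
Consecutive-¬between (inj₂ refl) (q+1<r , r<q) = <-asym (<-trans q+1<r r<q) (n<1+n _)

-- S(G) of a matching consists of paths u – uv – v with u < v and of isolated vertices v: the path
-- is placed at 3u, 3u + 1, 3u + 2 and the isolated vertex at 3v, so every edge joins consecutive
-- spine positions.
module MatchingSubdivision (G : SimpleGraph) (matching : IsMatching G) where

  HasSmallerNeighbour : Fin (n G) → Set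
  HasSmallerNeighbour v = ∃[ u ] u <ᶠ v × adj G u v ≡ true

  smallerNeighbour? : ∀ v → Dec (HasSmallerNeighbour v)
  smallerNeighbour? v = Fin.any? (λ u → (u Fin.<? v) ×-dec (adj G u v Bool.≟ true))

  ¬HasSmallerNeighbour-src : ∀ e → ¬ HasSmallerNeighbour (src {G} e)
  ¬HasSmallerNeighbour-src e (u , u<s , us)
    with matching {e = u , src {G} e , u<s , us} {f = e} (inj₂ refl) (inj₁ refl)
  ... | refl = Fin.<-irrefl refl u<s

  smallerNeighbour-tgt : ∀ e (smaller : HasSmallerNeighbour (tgt {G} e)) → proj₁ smaller ≡ src {G} e
  smallerNeighbour-tgt e (u , u<t , ut) =
    cong (src {G}) (matching {e = u , tgt {G} e , u<t , ut} {f = e} (inj₂ refl) (inj₂ refl))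

  vertexSpot : ∀ {v} → Dec (HasSmallerNeighbour v) → Fin (n G) × ℕ
  vertexSpot {v} (yes (u , _)) = u , 2
  vertexSpot {v} (no _) = v , 0

  spot : FV G → Fin (n G) × ℕ
  spot (inj₁ v) = vertexSpot (smallerNeighbour? v)
  spot (inj₂ e) = src {G} e , 1

  spot<3 : ∀ x → proj₂ (spot x) < 3
  spot<3 (inj₁ v) with smallerNeighbour? v
  ... | yes _ = s≤s (s≤s (s≤s z≤n))
  ... | no _ = s≤s z≤n
  spot<3 (inj₂ e) = s≤s (s≤s z≤n)

  position : FV G → ℕ
  position x = toℕ (proj₁ (spot x)) * 3 + proj₂ (spot x)

  position<3n : ∀ x → position x < n G * 3
  position<3n x =
    <-≤-trans (block-< {3} 0 (spot<3 x) (Fin.toℕ<n (proj₁ (spot x)))) (≤-reflexive (+-identityʳ _))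

  vertexSpot-injective : ∀ {v v′} (l : Dec (HasSmallerNeighbour v)) (l′ : Dec (HasSmallerNeighbour v′)) →
    vertexSpot l ≡ vertexSpot l′ → v ≡ v′
  vertexSpot-injective (yes (u , u<v , uv)) (yes (_ , u<v′ , uv′)) refl =
    cong (tgt {G}) (matching {e = u , _ , u<v , uv} {f = u , _ , u<v′ , uv′} (inj₁ refl) (inj₁ refl))
  vertexSpot-injective (no _) (no _) refl = refl
  vertexSpot-injective (yes _) (no _) ()
  vertexSpot-injective (no _) (yes _) ()

  vertexSpot-≢1 : ∀ {v} (l : Dec (HasSmallerNeighbour v)) → proj₂ (vertexSpot l) ≢ 1
  vertexSpot-≢1 (yes _) ()
  vertexSpot-≢1 (no _) ()

  spot-injective : ∀ x y → spot x ≡ spot y → x ≡ y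
  spot-injective (inj₁ v) (inj₁ v′) eq =
    cong inj₁ (vertexSpot-injective (smallerNeighbour? v) (smallerNeighbour? v′) eq)
  spot-injective (inj₂ e) (inj₂ f) eq = cong inj₂ (matching (inj₁ refl) (inj₁ (cong proj₁ eq)))
  spot-injective (inj₁ v) (inj₂ _) eq = ⊥-elim (vertexSpot-≢1 (smallerNeighbour? v) (cong proj₂ eq))
  spot-injective (inj₂ _) (inj₁ v) eq = ⊥-elim (vertexSpot-≢1 (smallerNeighbour? v) (cong proj₂ (sym eq)))

  position-injective : ∀ {x y} → position x ≡ position y → x ≡ y
  position-injective {x} {y} eq with block-injective {3} (spot<3 x) (spot<3 y) eq
  ... | same-anchor , same-slot = spot-injective x y (cong₂ _,_ (Fin.toℕ-injective same-anchor) same-slot)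

  position-src : ∀ e → position (inj₁ (src {G} e)) ≡ toℕ (src {G} e) * 3 + 0
  position-src e with smallerNeighbour? (src {G} e)
  ... | yes smaller = ⊥-elim (¬HasSmallerNeighbour-src e smaller)
  ... | no _ = refl

  position-tgt : ∀ e → position (inj₁ (tgt {G} e)) ≡ toℕ (src {G} e) * 3 + 2
  position-tgt e@(s , _ , s<t , st) with smallerNeighbour? (tgt {G} e)
  ... | yes smaller = cong (λ u → toℕ u * 3 + 2) (smallerNeighbour-tgt e smaller)
  ... | no none = ⊥-elim (none (s , s<t , st))

  incident-consecutive : ∀ {u} e → Incident {G} u e → Consecutive (position (inj₁ u)) (position (inj₂ e))
  incident-consecutive e (inj₁ refl) =
    inj₁ (trans (+-suc (toℕ (src {G} e) * 3) 0) (cong suc (sym (position-src e))))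
  incident-consecutive e (inj₂ refl) = inj₂ (trans (position-tgt e) (+-suc (toℕ (src {G} e) * 3) 1))

  S-adjacent-consecutive : ∀ {x y} → FAdj S G x y → Consecutive (position x) (position y)
  S-adjacent-consecutive {inj₁ _} {inj₂ e} ue = incident-consecutive e ue
  S-adjacent-consecutive {inj₂ e} {inj₁ _} ue with incident-consecutive e ue
  ... | inj₁ q≡p+1 = inj₂ q≡p+1
  ... | inj₂ p≡q+1 = inj₁ p≡q+1

  side : Fin (n G) → Edge G → Fin 2
  side u e with u Fin.≟ src {G} e
  ... | yes _ = zero
  ... | no _ = suc zero

  side-injective : ∀ {a b} e → Incident {G} a e → Incident {G} b e → side a e ≡ side b e → a ≡ b
  side-injective {a} {b} e ae be eq with a Fin.≟ src {G} e | b Fin.≟ src {G} e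
  ... | yes a≡s | yes b≡s = trans a≡s (sym b≡s)
  ... | no a≢s | no b≢s = trans (Incident-¬src⇒tgt {G} e ae a≢s) (sym (Incident-¬src⇒tgt {G} e be b≢s))
  side-injective e ae be () | yes _ | no _
  side-injective e ae be () | no _ | yes _

  page : FV G → FV G → Fin 2
  page (inj₁ u) (inj₂ e) = side u e
  page (inj₂ e) (inj₁ u) = side u e
  page _ _ = zero

  page-sym : ∀ x y → FAdj S G x y → page x y ≡ page y x
  page-sym (inj₁ _) (inj₂ _) _ = refl
  page-sym (inj₂ _) (inj₁ _) _ = refl

  page-matching : ∀ x y z → FAdj S G x y → FAdj S G x z → page x y ≡ page x z → y ≡ z
  page-matching (inj₁ _) (inj₂ _) (inj₂ _) ue uf _ = cong inj₂ (matching ue uf)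
  page-matching (inj₂ e) (inj₁ _) (inj₁ _) ae be eq = cong inj₁ (side-injective e ae be eq)

  embedding : MBE (FG S G) 2
  embedding = record
    { pos = position ; pos-inj = position-injective ; page = page ; page-sym = page-sym
    ; matching = page-matching
    ; noCross = λ _ _ _ _ uv _ _ (u<x , x<v , _) → Consecutive-¬between (S-adjacent-consecutive uv) (u<x , x<v) }

  HasSmallerNeighbour-tgt : ∀ e → HasSmallerNeighbour (tgt {G} e)
  HasSmallerNeighbour-tgt (s , _ , s<t , st) = s , s<t , st

  module _ (k : ℕ) where

    -- S(G) uses page 0 for the edges u – uv and page 1 for the edges uv – v. H-page q goes to
    -- page q + 1, except that H-page 0 goes to page 0 at a larger endpoint v, which leaves page 1 to uv – v.
    hPage : ∀ {w} → Dec (HasSmallerNeighbour w) → Fin (suc k) → Fin (2 + k)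
    hPage (yes _) zero = zero
    hPage (yes _) (suc q) = suc (suc q)
    hPage (no _) q = suc q

    σ : FV G → Fin (suc k) → Fin (2 + k)
    σ (inj₁ w) = hPage (smallerNeighbour? w)
    σ (inj₂ _) = suc

    hPage-injective : ∀ {w w′} (l : Dec (HasSmallerNeighbour w)) (l′ : Dec (HasSmallerNeighbour w′)) {q q′} →
      hPage l q ≡ hPage l′ q′ → q ≡ q′
    hPage-injective l l′ {q} {q′} eq =
      trans (sym (unshift-hPage l q)) (trans (cong unshift eq) (unshift-hPage l′ q′))
      where
      unshift : Fin (2 + k) → Fin (suc k)
      unshift zero = zero
      unshift (suc p) = p
      unshift-hPage : ∀ {w} (l : Dec (HasSmallerNeighbour w)) q → unshift (hPage l q) ≡ q
      unshift-hPage (yes _) zero = refl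
      unshift-hPage (yes _) (suc q) = refl
      unshift-hPage (no _) q = refl

    hPage-fresh : ∀ {w} e q → Incident {G} w e → side w e ↑ˡ k ≢ hPage (smallerNeighbour? w) q
    hPage-fresh {w} e q we with w Fin.≟ src {G} e | smallerNeighbour? w
    ... | yes refl | yes smaller = ⊥-elim (¬HasSmallerNeighbour-src e smaller)
    ... | yes _ | no _ = λ ()
    ... | no w≢s | no none =
      ⊥-elim (none (subst HasSmallerNeighbour (sym (Incident-¬src⇒tgt {G} e we w≢s))
                                               (HasSmallerNeighbour-tgt e)))
    hPage-fresh e zero we | no _ | yes _ = λ ()
    hPage-fresh e (suc q) we | no _ | yes _ = λ ()

matching-FSum-embedding : ∀ {G H k} → IsMatching G → Bipartite H → MBE (toGraph H) (suc k) →
  MBE (FSum S G H) (2 + k)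
matching-FSum-embedding {G} {H} {k} matching colouring eH =
  Product.embedding S G H colouring eH (MBE-inject embedding k) (n G * 3) position<3n (σ k)
    (λ {w} {w′} → hPage-injective k (smallerNeighbour? w) (smallerNeighbour? w′)) fresh unjumped
  where
  open MatchingSubdivision G matching
  fresh : ∀ {w y} q → FAdj S G (inj₁ w) y → MBE.page (MBE-inject embedding k) (inj₁ w) y ≢ σ k (inj₁ w) q
  fresh {y = inj₂ e} q we = hPage-fresh k e q we
  unjumped : ∀ w q → Unjumped (MBE-inject embedding k) (inj₁ w) (σ k (inj₁ w) q)
  unjumped _ _ ab _ = Consecutive-¬between (S-adjacent-consecutive ab)

module _ {G : SimpleGraph} {d : ℕ} where

  R-max-at-src : ∀ {e} → IsMaxDegree (FG R G) d → HasDegree (FG R G) (inj₂ e) d →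
    HasDegree (FG R G) (inj₁ (src {G} e)) d
  R-max-at-src {e} (bounded , _) e-deg with bounded (inj₁ (src {G} e))
  ... | b , src-deg , b≤d =
    subst (HasDegree (FG R G) _) (≤-antisym b≤d (R-degree-edge≤src e-deg src-deg)) src-deg

  T-max-at-src : ∀ {e} → IsMaxDegree (FG T G) d → HasDegree (FG T G) (inj₂ e) d →
    HasDegree (FG T G) (inj₁ (src {G} e)) d
  T-max-at-src {e} (bounded , _) e-deg with bounded (inj₁ (src {G} e)) | bounded (inj₁ (tgt {G} e))
  ... | b , src-deg , b≤d | c , tgt-deg , c≤d = subst (HasDegree (FG T G) _) (≤-antisym b≤d d≤b) src-deg
    where
    d≤b : d ≤ b
    d≤b = +-cancelʳ-≤ d d b (≤-trans (T-degree-edge-double e-deg src-deg tgt-deg) (+-monoʳ-≤ b c≤d))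

  S-max-only-at-subdivision⇒matching : ∀ {e} → IsMaxDegree (FG S G) d → HasDegree (FG S G) (inj₂ e) d →
    ¬ (∃[ w ] HasDegree (FG S G) (inj₁ w) d) → IsMatching G
  S-max-only-at-subdivision⇒matching max e-deg none = S-degrees<2⇒matching below-2
    where
    below-2 : ∀ w → Σ[ d′ ∈ ℕ ] HasDegree (FG S G) (inj₁ w) d′ × d′ < 2
    below-2 w with IsMaxDegree⇒below max (inj₁ w) (λ w-deg → none (w , w-deg))
    ... | d′ , w-deg , d′<d = d′ , w-deg , <-≤-trans d′<d (S-degree-edge≤2 e-deg)

  max-only-at-subdivision : ∀ {F} → IsMaxDegree (FG F G) d → Fin (n G) →
    ¬ (∃[ w ] HasDegree (FG F G) (inj₁ w) d) → Σ[ e ∈ Edge G ] HasDegree (FG F G) (inj₂ e) d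
  max-only-at-subdivision max w₀ none with maxDegree-attained max (inj₁ w₀)
  ... | inj₁ w , w-deg = ⊥-elim (none (w , w-deg))
  ... | inj₂ e , e-deg = e , e-deg

FSum-dispersable : ∀ F G H → Bipartite H → ∀ {dH dF} → IsMaxDegree (toGraph H) dH → MBE (toGraph H) dH →
  IsMaxDegree (FG F G) dF → MBE (FG F G) dF → ∀ {v} → HasDegree (FSum F G H) v (dF + dH) →
  Dispersable (FSum F G H)
FSum-dispersable F G H colouring maxH eH maxF eF v-deg =
  dispersable (FSum-degrees F G H (IsMaxDegree⇒degree maxF) (IsMaxDegree⇒degree maxH))
    (FSum-embedding F G H colouring eH eF) (_ , v-deg)

matching-FSum-dispersable : ∀ {G H k h dF} → Bipartite H → IsMaxDegree (toGraph H) (suc k) →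
  MBE (toGraph H) (suc k) → HasDegree (toGraph H) h (suc k) → IsMaxDegree (FG S G) dF → IsMatching G → Edge G →
  Dispersable (FSum S G H)
matching-FSum-dispersable {G} {H} colouring maxH eH h-deg maxF matching e =
  dispersable (FSum-degrees S G H (IsMaxDegree⇒degree maxF) (IsMaxDegree⇒degree maxH))
    (matching-FSum-embedding {G} {H} matching colouring eH)
    (_ , FSum-degree-vertex S G H (matching⇒S-degree-src matching e) h-deg)

Fin? : ∀ k → Dec (Fin k)
Fin? zero = no λ ()
Fin? (suc k) = yes zero

corollary3p4 : (F : Op) (G H : SimpleGraph) → Bipartite H → Dispersable (toGraph H) → Dispersable (FG F G) → Dispersable (FSum F G H)
corollary3p4 F G H colouring (dH , maxH , eH , _) (dF , maxF , eF , _) with Fin? (n G) | Fin? (n H)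
... | no ¬v | _ = dispersable-empty λ (x , _) → ¬v ([ id , src {G} ] x)
... | _ | no ¬h = dispersable-empty (¬h ∘ proj₂)
... | yes w₀ | yes h₀
  with maxDegree-attained maxH h₀ | Fin.any? (λ w → Count-dec (proj₂ (IsMaxDegree⇒degree maxF (inj₁ w))) dF)
...   | h , h-deg | yes (w , w-deg) =
        FSum-dispersable F G H colouring maxH eH maxF eF (FSum-degree-vertex F G H w-deg h-deg)
...   | h , h-deg | no none with max-only-at-subdivision {G} {dF} {F} maxF w₀ none | dH
...     | e , e-deg | zero = FSum-dispersable F G H colouring maxH eH maxF eF
          (subst (HasDegree (FSum F G H) (inj₂ e , h)) (sym (+-identityʳ dF)) (FSum-degree-edge F G H e-deg))
...     | e , e-deg | suc k with F
...       | S = matching-FSum-dispersable {G} {H} colouring maxH eH h-deg maxF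
                  (S-max-only-at-subdivision⇒matching maxF e-deg none) e
...       | R = ⊥-elim (none (src {G} e , R-max-at-src maxF e-deg))
...       | T = ⊥-elim (none (src {G} e , T-max-at-src maxF e-deg))
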